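{- Let $a,b,n$ be natural numbers with $a+b<n$ and $a<\frac{n}{2}<b$. Let $\mathcal{F}$ be an inclusion-maximal independent set of $\Gamma(n,a,b)$ and let $B\subseteq[n]$ with $|B|=b$. If the $\mathcal{F}$-weight of $B$ is less than $\binom{b}{a}$, then it is at most $\binom{b}{a}-\binom{n-b}{a}$.
   Context: $[n]=\{1,\dots,n\}$. The graph $\Gamma(n,a,b)$ has as vertices the pairs (flags) $(A,B)$ with $A\subseteq B\subseteq[n]$, $|A|=a$, $|B|=b$; under the assumptions $a+b<n$ and $a<n/2<b$, two vertices $(A_1,B_1),(A_2,B_2)$ are adjacent (called opposite) iff $B_1\cup B_2=[n]$, $A_1\cap B_2=\emptyset$ and $A_2\cap B_1=\emptyset$. An independent set is a set of pairwise non-adjacent vertices. For an independent set $\mathcal{F}$ and $B\subseteq[n]$ with $|B|=b$, the $\mathcal{F}$-weight of $B$ is the number of flags in $\mathcal{F}$ whose second component is $B$. -}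

module Defs where

open import Data.Nat using (ℕ; zero; suc; _+_; _*_; _<_; _≤_; _∸_)
open import Data.Nat.Combinatorics using (_C_)
open import Data.Bool using (Bool; true; false; T)
open import Data.Fin.Subset using (Subset; _⊆_; _∪_; _∩_; ∣_∣; ⊤; ⊥)
open import Data.Vec using (Vec; []; _∷_)
open import Data.List using (List; []; _∷_; map; _++_; length; filter)
open import Data.Product using (_×_; Σ; ∃; _,_)
open import Relation.Binary.PropositionalEquality using (_≡_)
open import Relation.Nullary using (¬_; Dec)
open import Relation.Nullary.Decidable using (_×-dec_)
open import Data.Nat.Properties using (_≟_)
open import Data.Bool.Properties using (T?)

allSubsets : (n : ℕ) → List (Subset n)
allSubsets zero = [] ∷ []
allSubsets (suc n) = map (false ∷_) (allSubsets n) ++ map (true ∷_) (allSubsets n)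

-- (A , B) is a vertex (flag) of Γ(n,a,b): A ⊆ B ⊆ [n], |A| = a, |B| = b.
IsFlag : {n : ℕ} → ℕ → ℕ → Subset n → Subset n → Set
IsFlag a b A B = (A ⊆ B) × (∣ A ∣ ≡ a) × (∣ B ∣ ≡ b)

-- Opposite (adjacent) flags: B₁ ∪ B₂ = [n], A₁ ∩ B₂ = ∅, A₂ ∩ B₁ = ∅.
Opposite : {n : ℕ} → Subset n → Subset n → Subset n → Subset n → Set
Opposite A₁ B₁ A₂ B₂ = (B₁ ∪ B₂ ≡ ⊤) × (A₁ ∩ B₂ ≡ ⊥) × (A₂ ∩ B₁ ≡ ⊥)

IsFamily : (n a b : ℕ) → (Subset n → Subset n → Bool) → Set
IsFamily n a b 𝓕 = ∀ A B → T (𝓕 A B) → IsFlag a b A B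

IsIndependent : (n : ℕ) → (Subset n → Subset n → Bool) → Set
IsIndependent n 𝓕 = ∀ A₁ B₁ A₂ B₂ → T (𝓕 A₁ B₁) → T (𝓕 A₂ B₂) →
  ¬ Opposite A₁ B₁ A₂ B₂

IsMaximalIndependent : (n a b : ℕ) → (Subset n → Subset n → Bool) → Set
IsMaximalIndependent n a b 𝓕 =
  IsFamily n a b 𝓕 × IsIndependent n 𝓕 ×
  (∀ A B → IsFlag a b A B → ¬ T (𝓕 A B) →
     ∃ λ A' → ∃ λ B' → T (𝓕 A' B') × Opposite A B A' B')

weight : {n : ℕ} → (Subset n → Subset n → Bool) → Subset n → ℕ
weight {n} 𝓕 B = length (filter (λ A → T? (𝓕 A B)) (allSubsets n))

-- If fewer than (b C a) flags of 𝓕 lie over B, some a-subset A of B has (A , B) ∉ 𝓕, so by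
-- maximality (A , B) is opposite to a member (A′ , B′). Then every a-subset of the complement
-- of B′ (of size n ∸ b) lies in B and forms with B a flag opposite to (A′ , B′), hence outside 𝓕.
-- These (n ∸ b) C a flags and the flags of 𝓕 over B are disjoint families of a-subsets of B.
module Submission where

open import Defs
open import Data.Nat using (ℕ; zero; suc; _+_; _*_; _<_; _≤_; _∸_; z≤n; s≤s)
open import Data.Nat.Properties
  using ( _≟_; suc-injective; +-suc; +-comm; +-identityʳ
        ; ≤-pred; m≤n⇒m≤1+n; n≤1+n; ≤-trans; m+n≤o⇒m≤o∸n)
open import Data.Nat.Combinatorics using (_C_; nCk+nC[k+1]≡[n+1]C[k+1])
open import Data.Bool using (Bool; true; false; T)
open import Data.Bool.Properties using (T?)
open import Data.Fin.Subset using (Subset; ∣_∣; _⊆_; _∪_; _∩_; ∁; ⊤; ⊥; _∈_; inside; outside)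
open import Data.Fin.Subset.Properties
  using ( _⊆?_; ⊆-trans; drop-∷-⊆; out⊆; in⊆in; ∈⊤; Empty-unique
        ; x∈p∩q⁻; x∈p∪q⁻; x∈∁p⇒x∉p; ∣∁p∣≡n∸∣p∣)
open import Data.Vec using ([]; _∷_; here)
open import Data.List using (List; []; _∷_; map; _++_; length; filter)
open import Data.List.Properties using (length-++; filter-++; filter-≐; filter-none)
open import Data.List.Relation.Unary.All using (universal)
open import Data.Product using (_×_; ∃; _,_)
open import Data.Sum using (inj₁; inj₂)
open import Data.Empty using (⊥-elim)
open import Level using (Level)
open import Relation.Nullary using (¬_; yes; no; does)
open import Relation.Nullary.Decidable using (_×-dec_)
open import Relation.Unary using (Pred; Decidable; _≐_) renaming (_⊆_ to _⇒_)
open import Relation.Binary.PropositionalEquality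
  using (_≡_; refl; sym; trans; cong; cong₂; subst; subst₂; module ≡-Reasoning)

private
  variable
    ℓ p q r : Level
    X Y : Set ℓ
    n k : ℕ

count : {P : Pred X p} → Decidable P → List X → ℕ
count P? xs = length (filter P? xs)

module _ {P : Pred X p} (P? : Decidable P) where

  count-++ : ∀ xs ys → count P? (xs ++ ys) ≡ count P? xs + count P? ys
  count-++ xs ys = trans (cong length (filter-++ P? xs ys)) (length-++ (filter P? xs))

  count-map : (f : Y → X) (ys : List Y) → count P? (map f ys) ≡ count (λ y → P? (f y)) ys
  count-map f [] = refl
  count-map f (y ∷ ys) with does (P? (f y))
  ... | true = cong suc (count-map f ys)
  ... | false = count-map f ys

  count-none : (∀ x → ¬ P x) → ∀ xs → count P? xs ≡ 0
  count-none ¬P xs = cong length (filter-none P? (universal ¬P xs))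

count-≐ : {P : Pred X p} {Q : Pred X q} (P? : Decidable P) (Q? : Decidable Q) →
          P ≐ Q → ∀ xs → count P? xs ≡ count Q? xs
count-≐ P? Q? P≐Q xs = cong length (filter-≐ P? Q? P≐Q xs)

module _ {P : Pred X p} {Q : Pred X q} {R : Pred X r}
         (P? : Decidable P) (Q? : Decidable Q) (R? : Decidable R) where

  count-disjoint-≤ : P ⇒ R → Q ⇒ R → (∀ {x} → P x → ¬ Q x) →
                     ∀ xs → count P? xs + count Q? xs ≤ count R? xs
  count-disjoint-≤ P⇒R Q⇒R P⇒¬Q [] = z≤n
  count-disjoint-≤ P⇒R Q⇒R P⇒¬Q (x ∷ xs)
    with ih ← count-disjoint-≤ P⇒R Q⇒R P⇒¬Q xs | P? x | Q? x | R? x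
  ... | yes px | yes qx | _      = ⊥-elim (P⇒¬Q px qx)
  ... | yes px | no _   | no ¬rx = ⊥-elim (¬rx (P⇒R px))
  ... | no _   | yes qx | no ¬rx = ⊥-elim (¬rx (Q⇒R qx))
  ... | yes _  | no _   | yes _  = s≤s ih
  ... | no _   | yes _  | yes _  rewrite +-suc (count P? xs) (count Q? xs) = s≤s ih
  ... | no _   | no _   | yes _  = m≤n⇒m≤1+n ih
  ... | no _   | no _   | no _   = ih

module _ {P : Pred X p} {R : Pred X r} (P? : Decidable P) (R? : Decidable R) where

  count<count⇒∃ : ∀ xs → count P? xs < count R? xs → ∃ λ x → R x × ¬ P x
  count<count⇒∃ (x ∷ xs) lt with P? x | R? x
  ... | no ¬px | yes rx = x , rx , ¬px
  ... | yes _  | yes _  = count<count⇒∃ xs (≤-pred lt)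
  ... | yes _  | no _   = count<count⇒∃ xs (≤-trans (n≤1+n _) lt)
  ... | no _   | no _   = count<count⇒∃ xs lt

count-allSubsets-suc : {P : Pred (Subset (suc n)) p} (P? : Decidable P) →
  count P? (allSubsets (suc n)) ≡
  count (λ A → P? (outside ∷ A)) (allSubsets n) + count (λ A → P? (inside ∷ A)) (allSubsets n)
count-allSubsets-suc {n} P? = begin
  count P? (map (outside ∷_) (allSubsets n) ++ map (inside ∷_) (allSubsets n))
    ≡⟨ count-++ P? (map (outside ∷_) (allSubsets n)) (map (inside ∷_) (allSubsets n)) ⟩
  count P? (map (outside ∷_) (allSubsets n)) + count P? (map (inside ∷_) (allSubsets n))
    ≡⟨ cong₂ _+_ (count-map P? (outside ∷_) (allSubsets n)) (count-map P? (inside ∷_) (allSubsets n)) ⟩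
  count (λ A → P? (outside ∷ A)) (allSubsets n) + count (λ A → P? (inside ∷ A)) (allSubsets n)
    ∎
  where open ≡-Reasoning

IsSubsetOfSize : ℕ → Subset n → Subset n → Set
IsSubsetOfSize k S A = A ⊆ S × ∣ A ∣ ≡ k

isSubsetOfSize? : ∀ k (S : Subset n) → Decidable (IsSubsetOfSize k S)
isSubsetOfSize? k S A = (A ⊆? S) ×-dec (∣ A ∣ ≟ k)

module _ {S : Subset n} where

  outside∷-isSubsetOfSize : ∀ {s} → (λ A → IsSubsetOfSize k (s ∷ S) (outside ∷ A)) ≐ IsSubsetOfSize k S
  outside∷-isSubsetOfSize = (λ (A⊆S , ∣A∣≡k) → drop-∷-⊆ A⊆S , ∣A∣≡k)
                          , (λ (A⊆S , ∣A∣≡k) → out⊆ A⊆S , ∣A∣≡k)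

  inside∷-isSubsetOfSize : (λ A → IsSubsetOfSize (suc k) (inside ∷ S) (inside ∷ A)) ≐ IsSubsetOfSize k S
  inside∷-isSubsetOfSize = (λ (A⊆S , ∣A∣≡k) → drop-∷-⊆ A⊆S , suc-injective ∣A∣≡k)
                         , (λ (A⊆S , ∣A∣≡k) → in⊆in A⊆S , cong suc ∣A∣≡k)

  inside∷-⊈-outside∷ : ∀ {A} → ¬ IsSubsetOfSize k (outside ∷ S) (inside ∷ A)
  inside∷-⊈-outside∷ (A⊆S , _) with A⊆S here
  ... | ()

  inside∷-size≢0 : ∀ {s A} → ¬ IsSubsetOfSize 0 (s ∷ S) (inside ∷ A)
  inside∷-size≢0 (_ , ())

count-subsetsOfSize : ∀ k (S : Subset n) → count (isSubsetOfSize? k S) (allSubsets n) ≡ ∣ S ∣ C k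
count-subsetsOfSize zero [] = refl
count-subsetsOfSize (suc k) [] = refl
count-subsetsOfSize {suc n} k (s ∷ S) = begin
  count (isSubsetOfSize? k (s ∷ S)) (allSubsets (suc n))
    ≡⟨ count-allSubsets-suc (isSubsetOfSize? k (s ∷ S)) ⟩
  count (λ A → isSubsetOfSize? k (s ∷ S) (outside ∷ A)) (allSubsets n) + #inside s k
    ≡⟨ cong (_+ #inside s k) (count-≐ _ (isSubsetOfSize? k S) outside∷-isSubsetOfSize (allSubsets n)) ⟩
  count (isSubsetOfSize? k S) (allSubsets n) + #inside s k
    ≡⟨ cong (_+ #inside s k) (count-subsetsOfSize k S) ⟩
  ∣ S ∣ C k + #inside s k
    ≡⟨ pascal s k ⟩
  ∣ s ∷ S ∣ C k
    ∎
  where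
  open ≡-Reasoning

  #inside : Bool → ℕ → ℕ
  #inside s k = count (λ A → isSubsetOfSize? k (s ∷ S) (inside ∷ A)) (allSubsets n)

  pascal : ∀ s k → ∣ S ∣ C k + #inside s k ≡ ∣ s ∷ S ∣ C k
  pascal outside k = begin
    ∣ S ∣ C k + #inside outside k
      ≡⟨ cong (∣ S ∣ C k +_) (count-none _ (λ _ → inside∷-⊈-outside∷) (allSubsets n)) ⟩
    ∣ S ∣ C k + 0
      ≡⟨ +-identityʳ _ ⟩
    ∣ S ∣ C k
      ∎
  pascal inside zero = cong (1 +_) (count-none _ (λ _ → inside∷-size≢0) (allSubsets n))
  pascal inside (suc k) = begin
    ∣ S ∣ C suc k + #inside inside (suc k)
      ≡⟨ cong (∣ S ∣ C suc k +_) (count-≐ _ (isSubsetOfSize? k S) inside∷-isSubsetOfSize (allSubsets n)) ⟩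
    ∣ S ∣ C suc k + count (isSubsetOfSize? k S) (allSubsets n)
      ≡⟨ cong (∣ S ∣ C suc k +_) (count-subsetsOfSize k S) ⟩
    ∣ S ∣ C suc k + ∣ S ∣ C k
      ≡⟨ +-comm (∣ S ∣ C suc k) (∣ S ∣ C k) ⟩
    ∣ S ∣ C k + ∣ S ∣ C suc k
      ≡⟨ nCk+nC[k+1]≡[n+1]C[k+1] ∣ S ∣ k ⟩
    suc ∣ S ∣ C suc k
      ∎

module _ {P Q : Subset n} where

  ∪≡⊤⇒∁⊆ : P ∪ Q ≡ ⊤ → ∁ Q ⊆ P
  ∪≡⊤⇒∁⊆ P∪Q≡⊤ {x} x∈∁Q with x∈p∪q⁻ P Q (subst (x ∈_) (sym P∪Q≡⊤) ∈⊤)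
  ... | inj₁ x∈P = x∈P
  ... | inj₂ x∈Q = ⊥-elim (x∈∁p⇒x∉p x∈∁Q x∈Q)

  ⊆∁⇒∩≡⊥ : P ⊆ ∁ Q → P ∩ Q ≡ ⊥
  ⊆∁⇒∩≡⊥ P⊆∁Q = Empty-unique λ (x , x∈P∩Q) →
    let (x∈P , x∈Q) = x∈p∩q⁻ P Q x∈P∩Q in x∈∁p⇒x∉p (P⊆∁Q x∈P) x∈Q

∃-missingFlag : ∀ {a} (𝓕 : Subset n → Subset n → Bool) (B : Subset n) →
  weight 𝓕 B < ∣ B ∣ C a → ∃ λ A → IsSubsetOfSize a B A × ¬ T (𝓕 A B)
∃-missingFlag {n} {a} 𝓕 B w<∣B∣Ca =
  count<count⇒∃ (λ A → T? (𝓕 A B)) (isSubsetOfSize? a B) (allSubsets n)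
    (subst (weight 𝓕 B <_) (sym (count-subsetsOfSize a B)) w<∣B∣Ca)

weight+∣∁B′∣Ca≤∣B∣Ca : ∀ {a b} {𝓕 : Subset n → Subset n → Bool} →
  IsFamily n a b 𝓕 → IsIndependent n 𝓕 → ∀ {A′ B′} B → T (𝓕 A′ B′) → B ∪ B′ ≡ ⊤ → A′ ∩ B ≡ ⊥ →
  weight 𝓕 B + ∣ ∁ B′ ∣ C a ≤ ∣ B ∣ C a
weight+∣∁B′∣Ca≤∣B∣Ca {n} {a} {𝓕 = 𝓕} family independent {A′} {B′} B A′B′∈𝓕 B∪B′≡⊤ A′∩B≡⊥ =
  subst₂ _≤_ (cong (weight 𝓕 B +_) (count-subsetsOfSize a (∁ B′))) (count-subsetsOfSize a B)
    (count-disjoint-≤ (λ A → T? (𝓕 A B)) (isSubsetOfSize? a (∁ B′)) (isSubsetOfSize? a B)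
      flagOver-B ∁B′-⊆-B opposite (allSubsets n))
  where
  flagOver-B : ∀ {A} → T (𝓕 A B) → IsSubsetOfSize a B A
  flagOver-B {A} AB∈𝓕 with A⊆B , ∣A∣≡a , _ ← family A B AB∈𝓕 = A⊆B , ∣A∣≡a

  ∁B′-⊆-B : ∀ {A} → IsSubsetOfSize a (∁ B′) A → IsSubsetOfSize a B A
  ∁B′-⊆-B (A⊆∁B′ , ∣A∣≡a) = ⊆-trans A⊆∁B′ (∪≡⊤⇒∁⊆ B∪B′≡⊤) , ∣A∣≡a

  opposite : ∀ {A} → T (𝓕 A B) → ¬ IsSubsetOfSize a (∁ B′) A
  opposite {A} AB∈𝓕 (A⊆∁B′ , _) =
    independent A B A′ B′ AB∈𝓕 A′B′∈𝓕 (B∪B′≡⊤ , ⊆∁⇒∩≡⊥ A⊆∁B′ , A′∩B≡⊥)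

lemma2p5 : (n a b : ℕ) → a + b < n → 2 * a < n → n < 2 * b →
    (𝓕 : Subset n → Subset n → Bool) → IsMaximalIndependent n a b 𝓕 →
    (B : Subset n) → ∣ B ∣ ≡ b →
    weight 𝓕 B < b C a →
    weight 𝓕 B ≤ b C a ∸ (n ∸ b) C a
lemma2p5 n a .(∣ B ∣) _ _ _ 𝓕 (family , independent , maximal) B refl w<bCa
  with A , (A⊆B , ∣A∣≡a) , AB∉𝓕 ← ∃-missingFlag 𝓕 B w<bCa
  with A′ , B′ , A′B′∈𝓕 , B∪B′≡⊤ , _ , A′∩B≡⊥ ← maximal A B (A⊆B , ∣A∣≡a , refl) AB∉𝓕
  with _ , _ , ∣B′∣≡∣B∣ ← family A′ B′ A′B′∈𝓕 =
  m+n≤o⇒m≤o∸n (weight 𝓕 B)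
    (subst (λ m → weight 𝓕 B + m C a ≤ ∣ B ∣ C a) (trans (∣∁p∣≡n∸∣p∣ B′) (cong (n ∸_) ∣B′∣≡∣B∣))
      (weight+∣∁B′∣Ca≤∣B∣Ca family independent B A′B′∈𝓕 B∪B′≡⊤ A′∩B≡⊥))
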